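{- Let $\mathbb{F}\in\{\mathbb{R},\mathbb{C}\}$, $d\geq 2$, $H=\mathbb{F}^d$. There exists a formula $\varphi$ with $\mathrm{Sat}_{\mathrm{STD}}^d(\varphi)$ and $\neg\mathrm{Sat}_{\mathrm{PBA}}^d(\varphi)$; more precisely, one may take $\varphi=(p\wedge(q\vee r))\wedge \neg\bigl((p\wedge q)\vee(p\wedge r)\bigr)$ for distinct atoms $p,q,r$.
   Context: $L(H)$ is the set of linear subspaces and $\mathrm{Proj}(H)$ the set of orthogonal projectors of $H=\mathbb{F}^d$ (standard inner product). Formulas are built from atoms by $\varphi ::= p_i \mid \neg\varphi \mid (\varphi\wedge\psi)\mid(\varphi\vee\psi)$. STD: a standard valuation $v$ maps atoms to $L(H)$; $[\![p_i]\!]=v(p_i)$, $[\![\neg\varphi]\!]=[\![\varphi]\!]^\perp$, $[\![\varphi\wedge\psi]\!]=[\![\varphi]\!]\cap[\![\psi]\!]$, $[\![\varphi\vee\psi]\!]=[\![\varphi]\!]+[\![\psi]\!]$; $\mathrm{Sat}_{\mathrm{STD}}^d(\varphi)$ iff some $v$ gives $[\![\varphi]\!]\neq\{0\}$. PBA: for a projector valuation $v$ (atoms $\to\mathrm{Proj}(H)$), values are defined recursively and partially: $[\![p_i]\!]=v(p_i)$; $[\![\neg\theta]\!]=I-[\![\theta]\!]$ if $[\![\theta]\!]$ defined; $[\![\alpha\wedge\beta]\!]=[\![\alpha]\!][\![\beta]\!]$ and $[\![\alpha\vee\beta]\!]=[\![\alpha]\!]+[\![\beta]\!]-[\![\alpha]\!][\![\beta]\!]$,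 each defined only if $[\![\alpha]\!],[\![\beta]\!]$ are defined and commute; $\mathrm{Sat}_{\mathrm{PBA}}^d(\varphi)$ iff some $v$ makes $[\![\varphi]\!]^{\mathrm{PBA}}_v$ defined and nonzero. -}

module Defs where

open import Data.Nat using (ℕ; zero; suc)
open import Data.Fin using (Fin; zero; suc; _≟_)
open import Data.Product using (Σ; ∃; _×_; _,_; proj₁; proj₂)
open import Relation.Binary.PropositionalEquality using (_≡_; _≢_)
open import Data.Sum using (_⊎_)
open import Relation.Nullary using (¬_; yes; no)

-- The real numbers, axiomatised as a complete ordered field
-- (any two models are isomorphic, so quantifying over all models
-- is the same as speaking about ℝ).

record CompleteOrderedField : Set₁ where
  infixl 6 _+_
  infixl 7 _*_
  infix 4 _≤_
  field
    R : Set
    0r 1r : R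
    _+_ _*_ : R → R → R
    -_ : R → R
    _≤_ : R → R → Set
    +-assoc : ∀ x y z → (x + y) + z ≡ x + (y + z)
    +-comm : ∀ x y → x + y ≡ y + x
    +-identityˡ : ∀ x → 0r + x ≡ x
    +-inverseˡ : ∀ x → (- x) + x ≡ 0r
    *-assoc : ∀ x y z → (x * y) * z ≡ x * (y * z)
    *-comm : ∀ x y → x * y ≡ y * x
    *-identityˡ : ∀ x → 1r * x ≡ x
    distribˡ : ∀ x y z → x * (y + z) ≡ x * y + x * z
    0≢1 : 0r ≢ 1r
    *-inverse : ∀ x → x ≢ 0r → Σ R (λ y → y * x ≡ 1r)
    ≤-refl : ∀ x → x ≤ x
    ≤-trans : ∀ {x y z} → x ≤ y → y ≤ z → x ≤ z
    ≤-antisym : ∀ {x y} → x ≤ y → y ≤ x → x ≡ y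
    ≤-total : ∀ x y → (x ≤ y) ⊎ (y ≤ x)
    +-mono-≤ : ∀ {x y} z → x ≤ y → x + z ≤ y + z
    *-nonneg : ∀ {x y} → 0r ≤ x → 0r ≤ y → 0r ≤ x * y
    complete : (S : R → Set) → Σ R S →
               Σ R (λ b → ∀ x → S x → x ≤ b) →
               Σ R (λ s → (∀ x → S x → x ≤ s) ×
                          (∀ b → (∀ x → S x → x ≤ b) → s ≤ b))

data FieldChoice : Set where
  realF complexF : FieldChoice

module Scalars (ℝ : CompleteOrderedField) where
  open CompleteOrderedField ℝ renaming (_+_ to _+r_; _*_ to _*r_; -_ to negr)

  -- ℂ is ℝ × ℝ (real part, imaginary part)
  F : FieldChoice → Set
  F realF = R
  F complexF = R × R

  zeroF oneF : (k : FieldChoice) → F k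
  zeroF realF = 0r
  zeroF complexF = 0r , 0r
  oneF realF = 1r
  oneF complexF = 1r , 0r

  addF mulF : (k : FieldChoice) → F k → F k → F k
  addF realF x y = x +r y
  addF complexF (a , b) (c , d) = (a +r c) , (b +r d)
  mulF realF x y = x *r y
  mulF complexF (a , b) (c , d) = (a *r c +r negr (b *r d)) , (a *r d +r b *r c)

  negF conjF : (k : FieldChoice) → F k → F k
  negF realF x = negr x
  negF complexF (a , b) = negr a , negr b
  conjF realF x = x
  conjF complexF (a , b) = a , negr b

  module Ops (k : FieldChoice) where
    𝔽 : Set
    𝔽 = F k

    0f 1f : 𝔽
    0f = zeroF k
    1f = oneF k

    _+f_ _*f_ : 𝔽 → 𝔽 → 𝔽
    _+f_ = addF k
    _*f_ = mulF k

    negf conj : 𝔽 → 𝔽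
    negf = negF k
    conj = conjF k

    _-f_ : 𝔽 → 𝔽 → 𝔽
    x -f y = x +f negf y

    Σf : ∀ {d} → (Fin d → 𝔽) → 𝔽
    Σf {zero} f = 0f
    Σf {suc d} f = f zero +f Σf (λ i → f (suc i))

data Formula : Set where
  atom : ℕ → Formula
  ¬' : Formula → Formula
  _∧'_ _∨'_ : Formula → Formula → Formula

module Hilbert (ℝ : CompleteOrderedField) (k : FieldChoice) (d : ℕ) where
  open Scalars ℝ
  open Ops k public

  Vec𝔽 : Set
  Vec𝔽 = Fin d → 𝔽

  _≈v_ : Vec𝔽 → Vec𝔽 → Set
  x ≈v y = ∀ i → x i ≡ y i

  0v : Vec𝔽
  0v i = 0f

  _+v_ : Vec𝔽 → Vec𝔽 → Vec𝔽
  (x +v y) i = x i +f y i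

  _·v_ : 𝔽 → Vec𝔽 → Vec𝔽
  (c ·v x) i = c *f x i

  ⟨_,_⟩ : Vec𝔽 → Vec𝔽 → 𝔽
  ⟨ x , y ⟩ = Σf (λ i → conj (x i) *f y i)

  Subset : Set₁
  Subset = Vec𝔽 → Set

  record IsSubspace (S : Subset) : Set where
    field
      respects : ∀ {x y} → x ≈v y → S x → S y
      zero∈ : S 0v
      +-closed : ∀ {x y} → S x → S y → S (x +v y)
      ·-closed : ∀ c {x} → S x → S (c ·v x)

  _⊥ : Subset → Subset
  (A ⊥) x = ∀ y → A y → ⟨ y , x ⟩ ≡ 0f

  _∩_ : Subset → Subset → Subset
  (A ∩ B) x = A x × B x

  _⊕_ : Subset → Subset → Subset
  (A ⊕ B) x = Σ Vec𝔽 (λ u → Σ Vec𝔽 (λ w → A u × B w × (x ≈v (u +v w))))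

  NonZeroSubspace : Subset → Set
  NonZeroSubspace A = Σ Vec𝔽 (λ x → A x × ¬ (x ≈v 0v))

  ⟦_⟧std : Formula → (ℕ → Subset) → Subset
  ⟦ atom i ⟧std v = v i
  ⟦ ¬' φ ⟧std v = (⟦ φ ⟧std v) ⊥
  ⟦ φ ∧' ψ ⟧std v = ⟦ φ ⟧std v ∩ ⟦ ψ ⟧std v
  ⟦ φ ∨' ψ ⟧std v = ⟦ φ ⟧std v ⊕ ⟦ ψ ⟧std v

  SatSTD : Formula → Set₁
  SatSTD φ = Σ (ℕ → Subset) (λ v → (∀ i → IsSubspace (v i)) ×
                                   NonZeroSubspace (⟦ φ ⟧std v))

  Mat : Set
  Mat = Fin d → Fin d → 𝔽

  _≈m_ : Mat → Mat → Set
  A ≈m B = ∀ i j → A i j ≡ B i j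

  0m Im : Mat
  0m i j = 0f
  Im i j with i Data.Fin.≟ j
  ... | yes _ = 1f
  ... | no _ = 0f

  _+m_ _-m_ _*m_ : Mat → Mat → Mat
  (A +m B) i j = A i j +f B i j
  (A -m B) i j = A i j -f B i j
  (A *m B) i j = Σf (λ l → A i l *f B l j)

  _† : Mat → Mat
  (A †) i j = conj (A j i)

  IsProjector : Mat → Set
  IsProjector P = ((P *m P) ≈m P) × ((P †) ≈m P)

  Commute : Mat → Mat → Set
  Commute A B = (A *m B) ≈m (B *m A)

  -- partial PBA semantics as a relation: PBAEval v φ P means that
  -- ⟦φ⟧ is defined under v and equals P
  data PBAEval (v : ℕ → Mat) : Formula → Mat → Set where
    ev-atom : ∀ i → PBAEval v (atom i) (v i)
    ev-¬ : ∀ {φ P} → PBAEval v φ P → PBAEval v (¬' φ) (Im -m P)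
    ev-∧ : ∀ {α β P Q} → PBAEval v α P → PBAEval v β Q → Commute P Q →
           PBAEval v (α ∧' β) (P *m Q)
    ev-∨ : ∀ {α β P Q} → PBAEval v α P → PBAEval v β Q → Commute P Q →
           PBAEval v (α ∨' β) ((P +m Q) -m (P *m Q))

  SatPBA : Formula → Set
  SatPBA φ = Σ (ℕ → Mat) (λ v → (∀ i → IsProjector (v i)) ×
               Σ Mat (λ P → PBAEval v φ P × ¬ (P ≈m 0m)))

distFormula : ℕ → ℕ → ℕ → Formula
distFormula p q r =
  (atom p ∧' (atom q ∨' atom r)) ∧'
  ¬' ((atom p ∧' atom q) ∨' (atom p ∧' atom r))

-- In the projector semantics every evaluated conjunction and disjunction is between commuting
-- projectors, and for commuting idempotents of any ring the distributive law
-- p(q ∨ r) = pq ∨ pr holds, where x ∨ y = x + y − xy.  The value of φ is therefore e(1 − e) = 0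
-- for the idempotent e = p(q ∨ r).  In the subspace lattice distributivity fails: for the
-- hyperplanes P = {x₀ = x₁}, Q = {x₁ = 0} and R = {x₀ = 0}, the vector e₀ + e₁ lies in
-- P ∩ (Q + R), while (P ∩ Q) + (P ∩ R) lies in {x₀ = x₁ = 0}, which is orthogonal to it.

{-# OPTIONS --safe #-}
module Submission where

open import Defs
open import Algebra.Bundles using (CommutativeRing; Ring)
open import Algebra.Consequences.Propositional
  using (comm∧idˡ⇒id; comm∧invˡ⇒inv; comm∧distrˡ⇒distrʳ)
import Algebra.Construct.Pointwise as Pointwise
open import Algebra.Core using (Op₁; Op₂)
open import Algebra.Structures using (IsCommutativeRing; IsRing)
open import Data.Fin using (Fin; zero; suc) renaming (_≟_ to _≟ᶠ_)
open import Data.Fin.Patterns using (0F; 1F)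
open import Data.Fin.Properties using (suc-injective)
open import Data.Nat using (ℕ; zero; suc; _≤_; s≤s; _≟_)
open import Data.Product using (_×_; _,_; proj₁)
open import Function using (const; _∘_)
open import Relation.Binary.PropositionalEquality
  using (_≡_; _≢_; refl; sym; trans; cong; cong₂; subst; isEquivalence; module ≡-Reasoning)
open import Relation.Nullary using (¬_; yes; no; contradiction)
open import Relation.Unary using (_⊆′_)

module CommutingIdempotents {c ℓ} (R : Ring c ℓ) where
  open Ring R renaming (sym to ≈-sym)
  open import Algebra.Definitions _≈_ using (_IdempotentOn_)
  open import Algebra.Properties.Ring R using (x[y-z]≈xy-xz; [y-z]x≈yx-zx; xyx⁻¹≈y)
  open import Algebra.Properties.Semigroup *-semigroup using (uv≈wx⇒yu∙vz≈yw∙xz)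
  open import Relation.Binary.Reasoning.Setoid setoid

  infixl 6 _∨_

  _∨_ : Carrier → Carrier → Carrier
  x ∨ y = x + y - x * y

  Idempotent : Carrier → Set ℓ
  Idempotent x = _*_ IdempotentOn x

  private
    -‿cong₂ : ∀ {x x′ y y′} → x ≈ x′ → y ≈ y′ → x - y ≈ x′ - y′
    -‿cong₂ x≈x′ y≈y′ = +-cong x≈x′ (-‿cong y≈y′)

  *-idempotent : ∀ {x y} → Idempotent x → Idempotent y → x * y ≈ y * x → Idempotent (x * y)
  *-idempotent {x} {y} xx≈x yy≈y xy≈yx = begin
    (x * y) * (x * y) ≈⟨ uv≈wx⇒yu∙vz≈yw∙xz (≈-sym xy≈yx) x y ⟩
    (x * x) * (y * y) ≈⟨ *-cong xx≈x yy≈y ⟩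
    x * y             ∎

  [x∨y]x≈x : ∀ {x y} → Idempotent x → x * y ≈ y * x → (x ∨ y) * x ≈ x
  [x∨y]x≈x {x} {y} xx≈x xy≈yx = begin
    (x + y - x * y) * x           ≈⟨ [y-z]x≈yx-zx x (x + y) (x * y) ⟩
    (x + y) * x - x * y * x       ≈⟨ -‿cong₂ (distribʳ x x y) (*-assoc x y x) ⟩
    (x * x + y * x) - x * (y * x) ≈⟨ -‿cong₂ (+-congˡ (≈-sym xy≈yx)) (*-congˡ (≈-sym xy≈yx)) ⟩
    (x * x + x * y) - x * (x * y) ≈⟨ -‿cong₂ (+-congʳ xx≈x) (≈-sym (*-assoc x x y)) ⟩
    (x + x * y) - (x * x) * y     ≈⟨ -‿cong₂ (+-comm x (x * y)) (*-congʳ xx≈x) ⟩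
    (x * y + x) - x * y           ≈⟨ xyx⁻¹≈y (x * y) x ⟩
    x                             ∎

  [x∨y]y≈y : ∀ {x y} → Idempotent y → (x ∨ y) * y ≈ y
  [x∨y]y≈y {x} {y} yy≈y = begin
    (x + y - x * y) * y           ≈⟨ [y-z]x≈yx-zx y (x + y) (x * y) ⟩
    (x + y) * y - x * y * y       ≈⟨ -‿cong₂ (distribʳ y x y) (*-assoc x y y) ⟩
    (x * y + y * y) - x * (y * y) ≈⟨ -‿cong₂ (+-congˡ yy≈y) (*-congˡ yy≈y) ⟩
    (x * y + y) - x * y           ≈⟨ xyx⁻¹≈y (x * y) y ⟩
    y                             ∎

  ∨-idempotent : ∀ {x y} → Idempotent x → Idempotent y → x * y ≈ y * x → Idempotent (x ∨ y)
  ∨-idempotent {x} {y} xx≈x yy≈y xy≈yx = begin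
    (x ∨ y) * (x + y - x * y)                   ≈⟨ x[y-z]≈xy-xz (x ∨ y) (x + y) (x * y) ⟩
    (x ∨ y) * (x + y) - (x ∨ y) * (x * y)       ≈⟨ -‿cong₂ (distribˡ (x ∨ y) x y) (≈-sym (*-assoc (x ∨ y) x y)) ⟩
    ((x ∨ y) * x + (x ∨ y) * y) - (x ∨ y) * x * y
      ≈⟨ -‿cong₂ (+-cong ([x∨y]x≈x xx≈x xy≈yx) ([x∨y]y≈y yy≈y)) (*-congʳ ([x∨y]x≈x xx≈x xy≈yx)) ⟩
    x + y - x * y                               ∎

  x[y∨z]≈xy∨xz : ∀ {x y z} → Idempotent x → x * y ≈ y * x → x * (y ∨ z) ≈ x * y ∨ x * z
  x[y∨z]≈xy∨xz {x} {y} {z} xx≈x xy≈yx = begin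
    x * (y + z - y * z)                 ≈⟨ x[y-z]≈xy-xz x (y + z) (y * z) ⟩
    x * (y + z) - x * (y * z)           ≈⟨ -‿cong₂ (distribˡ x y z) (*-congʳ (≈-sym xx≈x)) ⟩
    (x * y + x * z) - (x * x) * (y * z) ≈⟨ +-congˡ (-‿cong (uv≈wx⇒yu∙vz≈yw∙xz (≈-sym xy≈yx) x z)) ⟨
    (x * y + x * z) - (x * y) * (x * z) ∎

  x[1-x]≈0 : ∀ {x} → Idempotent x → x * (1# - x) ≈ 0#
  x[1-x]≈0 {x} xx≈x = begin
    x * (1# - x)      ≈⟨ x[y-z]≈xy-xz x 1# x ⟩
    x * 1# - x * x    ≈⟨ -‿cong₂ (*-identityʳ x) xx≈x ⟩
    x - x             ≈⟨ -‿inverseʳ x ⟩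
    0#                ∎

  x[y∨z][1-[xy∨xz]]≈0 : ∀ {x y z} → Idempotent x → Idempotent y → Idempotent z →
    y * z ≈ z * y → x * y ≈ y * x → x * (y ∨ z) ≈ (y ∨ z) * x →
    x * (y ∨ z) * (1# - (x * y ∨ x * z)) ≈ 0#
  x[y∨z][1-[xy∨xz]]≈0 {x} {y} {z} xx≈x yy≈y zz≈z yz≈zy xy≈yx x[y∨z]≈[y∨z]x = begin
    x * (y ∨ z) * (1# - (x * y ∨ x * z)) ≈⟨ *-congˡ (+-congˡ (-‿cong (x[y∨z]≈xy∨xz xx≈x xy≈yx))) ⟨
    x * (y ∨ z) * (1# - x * (y ∨ z))     ≈⟨ x[1-x]≈0 (*-idempotent xx≈x (∨-idempotent yy≈y zz≈z yz≈zy) x[y∨z]≈[y∨z]x) ⟩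
    0#                                   ∎

module Complexification
  {a} {A : Set a} {add mul : Op₂ A} {neg : Op₁ A} {zero# one# : A}
  (isCommutativeRing : IsCommutativeRing _≡_ add mul neg zero# one#)
  where

  private
    R : CommutativeRing a a
    R = record { isCommutativeRing = isCommutativeRing }
  open CommutativeRing R using (_+_; _*_; -_; 0#; 1#; +-assoc; +-comm; +-identityˡ; +-identityʳ; -‿inverseˡ;
    *-assoc; *-comm; *-identityˡ; distribˡ; distribʳ; zeroˡ; _-_; ring; +-commutativeSemigroup)
  open import Algebra.Properties.Ring ring using (-0#≈0#; -‿+-comm; x[y-z]≈xy-xz; [y-z]x≈yx-zx)
  open import Algebra.Properties.CommutativeSemigroup +-commutativeSemigroup
    using (interchange; x∙yz≈y∙zx)
  open ≡-Reasoning

  infixl 6 _+ᵢ_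
  infixl 7 _*ᵢ_

  _+ᵢ_ _*ᵢ_ : Op₂ (A × A)
  (a , b) +ᵢ (c , d) = a + c , b + d
  (a , b) *ᵢ (c , d) = a * c - b * d , a * d + b * c

  -ᵢ_ : Op₁ (A × A)
  -ᵢ (a , b) = - a , - b

  0ᵢ 1ᵢ : A × A
  0ᵢ = 0# , 0#
  1ᵢ = 1# , 0#

  private
    x-y-z≡x-[y+z] : ∀ x y z → x - y - z ≡ x - (y + z)
    x-y-z≡x-[y+z] x y z = trans (+-assoc x (- y) (- z)) (cong (x +_) (-‿+-comm y z))

  *ᵢ-comm : ∀ x y → x *ᵢ y ≡ y *ᵢ x
  *ᵢ-comm (a , b) (c , d) =
    cong₂ _,_ (cong₂ _-_ (*-comm a c) (*-comm b d))
              (trans (+-comm (a * d) (b * c)) (cong₂ _+_ (*-comm b c) (*-comm a d)))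

  *ᵢ-identityˡ : ∀ x → 1ᵢ *ᵢ x ≡ x
  *ᵢ-identityˡ (a , b) = cong₂ _,_
    (begin
      1# * a - 0# * b ≡⟨ cong₂ _-_ (*-identityˡ a) (zeroˡ b) ⟩
      a - 0#          ≡⟨ cong (a +_) -0#≈0# ⟩
      a + 0#          ≡⟨ +-identityʳ a ⟩
      a               ∎)
    (begin
      1# * b + 0# * a ≡⟨ cong₂ _+_ (*-identityˡ b) (zeroˡ a) ⟩
      b + 0#          ≡⟨ +-identityʳ b ⟩
      b               ∎)

  *ᵢ-distribˡ : ∀ x y z → x *ᵢ (y +ᵢ z) ≡ x *ᵢ y +ᵢ x *ᵢ z
  *ᵢ-distribˡ (a , b) (c , d) (e , f) = cong₂ _,_
    (begin
      a * (c + e) - b * (d + f)           ≡⟨ cong₂ _-_ (distribˡ a c e) (distribˡ b d f) ⟩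
      (a * c + a * e) - (b * d + b * f)   ≡⟨ cong ((a * c + a * e) +_) (sym (-‿+-comm (b * d) (b * f))) ⟩
      (a * c + a * e) + (- (b * d) + - (b * f)) ≡⟨ interchange (a * c) (a * e) _ _ ⟩
      (a * c - b * d) + (a * e - b * f)   ∎)
    (begin
      a * (d + f) + b * (c + e)           ≡⟨ cong₂ _+_ (distribˡ a d f) (distribˡ b c e) ⟩
      (a * d + a * f) + (b * c + b * e)   ≡⟨ interchange (a * d) (a * f) (b * c) (b * e) ⟩
      (a * d + b * c) + (a * f + b * e)   ∎)

  *ᵢ-assoc : ∀ x y z → (x *ᵢ y) *ᵢ z ≡ x *ᵢ (y *ᵢ z)
  *ᵢ-assoc (a , b) (c , d) (e , f) = cong₂ _,_
    (begin
      (a * c - b * d) * e - (a * d + b * c) * f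
        ≡⟨ cong₂ _-_ ([y-z]x≈yx-zx e (a * c) (b * d)) (distribʳ f (a * d) (b * c)) ⟩
      (a * c * e - b * d * e) - (a * d * f + b * c * f)
        ≡⟨ cong₂ _-_ (cong₂ _-_ (*-assoc a c e) (*-assoc b d e))
                     (cong₂ _+_ (*-assoc a d f) (*-assoc b c f)) ⟩
      (a * (c * e) - b * (d * e)) - (a * (d * f) + b * (c * f))
        ≡⟨ x-y-z≡x-[y+z] (a * (c * e)) _ _ ⟩
      a * (c * e) - (b * (d * e) + (a * (d * f) + b * (c * f)))
        ≡⟨ cong (λ t → a * (c * e) - t) (x∙yz≈y∙zx (b * (d * e)) _ _) ⟩
      a * (c * e) - (a * (d * f) + (b * (c * f) + b * (d * e)))
        ≡⟨ x-y-z≡x-[y+z] (a * (c * e)) _ _ ⟨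
      (a * (c * e) - a * (d * f)) - (b * (c * f) + b * (d * e))
        ≡⟨ cong₂ _-_ (x[y-z]≈xy-xz a (c * e) (d * f)) (distribˡ b (c * f) (d * e)) ⟨
      a * (c * e - d * f) - b * (c * f + d * e) ∎)
    (begin
      (a * c - b * d) * f + (a * d + b * c) * e
        ≡⟨ cong₂ _+_ ([y-z]x≈yx-zx f (a * c) (b * d)) (distribʳ e (a * d) (b * c)) ⟩
      (a * c * f - b * d * f) + (a * d * e + b * c * e)
        ≡⟨ cong₂ _+_ (cong₂ _-_ (*-assoc a c f) (*-assoc b d f))
                     (cong₂ _+_ (*-assoc a d e) (*-assoc b c e)) ⟩
      (a * (c * f) - b * (d * f)) + (a * (d * e) + b * (c * e))
        ≡⟨ interchange (a * (c * f)) _ _ _ ⟩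
      (a * (c * f) + a * (d * e)) + (- (b * (d * f)) + b * (c * e))
        ≡⟨ cong ((a * (c * f) + a * (d * e)) +_) (+-comm (b * (c * e)) (- (b * (d * f)))) ⟨
      (a * (c * f) + a * (d * e)) + (b * (c * e) - b * (d * f))
        ≡⟨ cong₂ _+_ (distribˡ a (c * f) (d * e)) (x[y-z]≈xy-xz b (c * e) (d * f)) ⟨
      a * (c * f + d * e) + b * (c * e - d * f) ∎)

  isCommutativeRingᵢ : IsCommutativeRing _≡_ _+ᵢ_ _*ᵢ_ -ᵢ_ 0ᵢ 1ᵢ
  isCommutativeRingᵢ = record
    { isRing = record
      { +-isAbelianGroup = record
        { isGroup = record
          { isMonoid = record
            { isSemigroup = record
              { isMagma = record { isEquivalence = isEquivalence ; ∙-cong = cong₂ _+ᵢ_ }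
              ; assoc = λ (a , b) (c , d) (e , f) → cong₂ _,_ (+-assoc a c e) (+-assoc b d f)
              }
            ; identity = comm∧idˡ⇒id +ᵢ-comm λ (a , b) → cong₂ _,_ (+-identityˡ a) (+-identityˡ b)
            }
          ; inverse = comm∧invˡ⇒inv +ᵢ-comm λ (a , b) → cong₂ _,_ (-‿inverseˡ a) (-‿inverseˡ b)
          ; ⁻¹-cong = cong -ᵢ_
          }
        ; comm = +ᵢ-comm
        }
      ; *-cong = cong₂ _*ᵢ_
      ; *-assoc = *ᵢ-assoc
      ; *-identity = comm∧idˡ⇒id *ᵢ-comm *ᵢ-identityˡ
      ; distrib = *ᵢ-distribˡ , comm∧distrˡ⇒distrʳ *ᵢ-comm *ᵢ-distribˡ
      }
    ; *-comm = *ᵢ-comm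
    }
    where
    +ᵢ-comm : ∀ x y → x +ᵢ y ≡ y +ᵢ x
    +ᵢ-comm (a , b) (c , d) = cong₂ _,_ (+-comm a c) (+-comm b d)

ℝ-isCommutativeRing : (ℝ : CompleteOrderedField) → let open CompleteOrderedField ℝ in
                      IsCommutativeRing _≡_ _+_ _*_ -_ 0r 1r
ℝ-isCommutativeRing ℝ = record
  { isRing = record
    { +-isAbelianGroup = record
      { isGroup = record
        { isMonoid = record
          { isSemigroup = record
            { isMagma = record { isEquivalence = isEquivalence ; ∙-cong = cong₂ _+_ }
            ; assoc = +-assoc
            }
          ; identity = comm∧idˡ⇒id +-comm +-identityˡ
          }
        ; inverse = comm∧invˡ⇒inv +-comm +-inverseˡ
        ; ⁻¹-cong = cong -_
        }
      ; comm = +-comm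
      }
    ; *-cong = cong₂ _*_
    ; *-assoc = *-assoc
    ; *-identity = comm∧idˡ⇒id *-comm *-identityˡ
    ; distrib = distribˡ , comm∧distrˡ⇒distrʳ *-comm distribˡ
    }
  ; *-comm = *-comm
  }
  where open CompleteOrderedField ℝ

module ScalarField (ℝ : CompleteOrderedField) where
  open Scalars ℝ
  open CompleteOrderedField ℝ using (0≢1)

  𝔽-isCommutativeRing : ∀ k → IsCommutativeRing _≡_ (addF k) (mulF k) (negF k) (zeroF k) (oneF k)
  𝔽-isCommutativeRing realF = ℝ-isCommutativeRing ℝ
  𝔽-isCommutativeRing complexF = Complexification.isCommutativeRingᵢ (ℝ-isCommutativeRing ℝ)

  𝔽-commutativeRing : FieldChoice → CommutativeRing _ _
  𝔽-commutativeRing k = record { isCommutativeRing = 𝔽-isCommutativeRing k }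

  conj-zero : ∀ k → conjF k (zeroF k) ≡ zeroF k
  conj-zero realF = refl
  conj-zero complexF = cong (_ ,_) -0#≈0#
    where open import Algebra.Properties.Ring (CommutativeRing.ring (𝔽-commutativeRing realF))

  one≢zero : ∀ k → oneF k ≢ zeroF k
  one≢zero realF 1≡0 = 0≢1 (sym 1≡0)
  one≢zero complexF 1≡0 = 0≢1 (sym (cong proj₁ 1≡0))

module Sums (ℝ : CompleteOrderedField) (k : FieldChoice) where
  open Scalars ℝ
  open Ops k
  open CommutativeRing (ScalarField.𝔽-commutativeRing ℝ k)
    using (+-identityˡ; +-identityʳ; +-commutativeSemigroup; zeroˡ; zeroʳ; *-identityʳ; distribˡ; distribʳ)
  open import Algebra.Properties.CommutativeSemigroup +-commutativeSemigroup using (interchange)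

  Σf-cong : ∀ {n} {f g : Fin n → 𝔽} → (∀ i → f i ≡ g i) → Σf f ≡ Σf g
  Σf-cong {zero} f≗g = refl
  Σf-cong {suc n} f≗g = cong₂ _+f_ (f≗g zero) (Σf-cong (f≗g ∘ suc))

  Σf-zero : ∀ {n} {f : Fin n → 𝔽} → (∀ i → f i ≡ 0f) → Σf f ≡ 0f
  Σf-zero {zero} f≗0 = refl
  Σf-zero {suc n} f≗0 = trans (cong₂ _+f_ (f≗0 zero) (Σf-zero (f≗0 ∘ suc))) (+-identityˡ 0f)

  Σf-distrib-+ : ∀ {n} (f g : Fin n → 𝔽) → Σf (λ i → f i +f g i) ≡ Σf f +f Σf g
  Σf-distrib-+ {zero} f g = sym (+-identityˡ 0f)
  Σf-distrib-+ {suc n} f g =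
    trans (cong ((f zero +f g zero) +f_) (Σf-distrib-+ (f ∘ suc) (g ∘ suc)))
          (interchange (f zero) (g zero) (Σf (f ∘ suc)) (Σf (g ∘ suc)))

  *-distribˡ-Σf : ∀ {n} c (f : Fin n → 𝔽) → c *f Σf f ≡ Σf (λ i → c *f f i)
  *-distribˡ-Σf {zero} c f = zeroʳ c
  *-distribˡ-Σf {suc n} c f =
    trans (distribˡ c (f zero) (Σf (f ∘ suc))) (cong ((c *f f zero) +f_) (*-distribˡ-Σf c (f ∘ suc)))

  *-distribʳ-Σf : ∀ {n} c (f : Fin n → 𝔽) → Σf f *f c ≡ Σf (λ i → f i *f c)
  *-distribʳ-Σf {zero} c f = zeroˡ c
  *-distribʳ-Σf {suc n} c f =
    trans (distribʳ c (f zero) (Σf (f ∘ suc))) (cong ((f zero *f c) +f_) (*-distribʳ-Σf c (f ∘ suc)))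

  Σf-comm : ∀ {m n} (f : Fin m → Fin n → 𝔽) →
            Σf (λ i → Σf (λ j → f i j)) ≡ Σf (λ j → Σf (λ i → f i j))
  Σf-comm {zero} {n} f = sym (Σf-zero {n} λ _ → refl)
  Σf-comm {suc m} f =
    trans (cong (Σf (f zero) +f_) (Σf-comm (f ∘ suc)))
          (sym (Σf-distrib-+ (f zero) (λ j → Σf (λ i → f (suc i) j))))

  Σf-select : ∀ {n} (f g : Fin n → 𝔽) j → g j ≡ 1f → (∀ l → l ≢ j → g l ≡ 0f) →
              Σf (λ l → f l *f g l) ≡ f j
  Σf-select f g zero gj≡1 g≡0 =
    trans (cong₂ _+f_ (trans (cong (f zero *f_) gj≡1) (*-identityʳ (f zero)))
                      (Σf-zero λ l → trans (cong (f (suc l) *f_) (g≡0 (suc l) λ ())) (zeroʳ _)))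
          (+-identityʳ (f zero))
  Σf-select f g (suc j) gj≡1 g≡0 =
    trans (cong₂ _+f_ (trans (cong (f zero *f_) (g≡0 zero λ ())) (zeroʳ (f zero)))
                      (Σf-select (f ∘ suc) (g ∘ suc) j gj≡1 λ l l≢j → g≡0 (suc l) (l≢j ∘ suc-injective)))
          (+-identityˡ (f (suc j)))

module MatrixRing (ℝ : CompleteOrderedField) (k : FieldChoice) (d : ℕ) where
  open Hilbert ℝ k d
  open Sums ℝ k
  open CommutativeRing (ScalarField.𝔽-commutativeRing ℝ k)
    using (+-isAbelianGroup; *-assoc; *-comm; distribˡ; distribʳ)

  negm : Op₁ Mat
  negm A i j = negf (A i j)

  Im-diagonal : ∀ i → Im i i ≡ 1f
  Im-diagonal i with i ≟ᶠ i
  ... | yes _ = refl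
  ... | no i≢i = contradiction refl i≢i

  Im-off-diagonal : ∀ {i j} → i ≢ j → Im i j ≡ 0f
  Im-off-diagonal {i} {j} i≢j with i ≟ᶠ j
  ... | yes i≡j = contradiction i≡j i≢j
  ... | no _ = refl

  *m-cong : ∀ {A A′ B B′} → A ≈m A′ → B ≈m B′ → (A *m B) ≈m (A′ *m B′)
  *m-cong A≈A′ B≈B′ i j = Σf-cong λ l → cong₂ _*f_ (A≈A′ i l) (B≈B′ l j)

  *m-assoc : ∀ A B C → ((A *m B) *m C) ≈m (A *m (B *m C))
  *m-assoc A B C i j = begin
    Σf (λ l → Σf (λ m → A i m *f B m l) *f C l j)  ≡⟨ Σf-cong {d} (λ l → *-distribʳ-Σf (C l j) (λ m → A i m *f B m l)) ⟩
    Σf (λ l → Σf (λ m → (A i m *f B m l) *f C l j)) ≡⟨ Σf-comm {d} {d} _ ⟩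
    Σf (λ m → Σf (λ l → (A i m *f B m l) *f C l j)) ≡⟨ Σf-cong {d} (λ m → Σf-cong {d} λ l → *-assoc (A i m) _ _) ⟩
    Σf (λ m → Σf (λ l → A i m *f (B m l *f C l j))) ≡⟨ Σf-cong {d} (λ m → *-distribˡ-Σf (A i m) (λ l → B m l *f C l j)) ⟨
    Σf (λ m → A i m *f Σf (λ l → B m l *f C l j))  ∎
    where open ≡-Reasoning

  *m-identityˡ : ∀ A → (Im *m A) ≈m A
  *m-identityˡ A i j =
    trans (Σf-cong λ l → *-comm (Im i l) (A l j))
          (Σf-select (λ l → A l j) (Im i) i (Im-diagonal i) λ l l≢i → Im-off-diagonal (l≢i ∘ sym))

  *m-identityʳ : ∀ A → (A *m Im) ≈m A
  *m-identityʳ A i j = Σf-select (A i) (λ l → Im l j) j (Im-diagonal j) λ l → Im-off-diagonal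

  *m-distribˡ : ∀ A B C → (A *m (B +m C)) ≈m ((A *m B) +m (A *m C))
  *m-distribˡ A B C i j = trans (Σf-cong λ l → distribˡ (A i l) (B l j) (C l j)) (Σf-distrib-+ {d} _ _)

  *m-distribʳ : ∀ A B C → ((B +m C) *m A) ≈m ((B *m A) +m (C *m A))
  *m-distribʳ A B C i j = trans (Σf-cong λ l → distribʳ (A l j) (B i l) (C i l)) (Σf-distrib-+ {d} _ _)

  Mat-isRing : IsRing _≈m_ _+m_ _*m_ negm 0m Im
  Mat-isRing = record
    { +-isAbelianGroup = Pointwise.isAbelianGroup (Fin d) (Pointwise.isAbelianGroup (Fin d) +-isAbelianGroup)
    ; *-cong = *m-cong
    ; *-assoc = *m-assoc
    ; *-identity = *m-identityˡ , *m-identityʳ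
    ; distrib = *m-distribˡ , *m-distribʳ
    }

  Mat-ring : Ring _ _
  Mat-ring = record { isRing = Mat-isRing }

module ProjectorSemantics (ℝ : CompleteOrderedField) (k : FieldChoice) (d : ℕ) where
  open Hilbert ℝ k d
  open CommutingIdempotents (MatrixRing.Mat-ring ℝ k d)

  ¬SatPBA-distFormula : ∀ p q r → ¬ SatPBA (distFormula p q r)
  ¬SatPBA-distFormula p q r
    (v , isProjector , _ ,
     ev-∧ (ev-∧ (ev-atom _) (ev-∨ (ev-atom _) (ev-atom _) QR≈RQ) P[Q∨R]≈[Q∨R]P)
          (ev-¬ (ev-∨ (ev-∧ (ev-atom _) (ev-atom _) PQ≈QP) (ev-∧ (ev-atom _) (ev-atom _) _) _)) _ ,
     value≉0) =
    value≉0 (x[y∨z][1-[xy∨xz]]≈0 (idempotent p) (idempotent q) (idempotent r) QR≈RQ PQ≈QP P[Q∨R]≈[Q∨R]P)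
    where
    idempotent : ∀ i → Idempotent (v i)
    idempotent i = proj₁ (isProjector i)

module _ {a} {A : Set a} where

  infixl 5 _[_]≔_

  _[_]≔_ : (ℕ → A) → ℕ → A → ℕ → A
  (f [ i ]≔ x) j with j ≟ i
  ... | yes _ = x
  ... | no  _ = f j

  []≔-updates : ∀ f i (x : A) → (f [ i ]≔ x) i ≡ x
  []≔-updates f i x with i ≟ i
  ... | yes _ = refl
  ... | no i≢i = contradiction refl i≢i

  []≔-minimal : ∀ f {i j} (x : A) → j ≢ i → (f [ i ]≔ x) j ≡ f j
  []≔-minimal f {i} {j} x j≢i with j ≟ i
  ... | yes j≡i = contradiction j≡i j≢i
  ... | no  _ = refl

  []≔-preserves : ∀ {p} (P : A → Set p) {f x} i → (∀ j → P (f j)) → P x → ∀ j → P ((f [ i ]≔ x) j)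
  []≔-preserves P {f} i Pf Px j with j ≟ i
  ... | yes _ = Px
  ... | no  _ = Pf j

module Subspaces (ℝ : CompleteOrderedField) (k : FieldChoice) (d : ℕ) where
  open Hilbert ℝ k d
  open CommutativeRing (ScalarField.𝔽-commutativeRing ℝ k) using (+-identityˡ; zeroʳ)

  ∩-isSubspace : ∀ {A B} → IsSubspace A → IsSubspace B → IsSubspace (A ∩ B)
  ∩-isSubspace A B = record
    { respects = λ x≈y (x∈A , x∈B) → A.respects x≈y x∈A , B.respects x≈y x∈B
    ; zero∈ = A.zero∈ , B.zero∈
    ; +-closed = λ (x∈A , x∈B) (y∈A , y∈B) → A.+-closed x∈A y∈A , B.+-closed x∈B y∈B
    ; ·-closed = λ c (x∈A , x∈B) → A.·-closed c x∈A , B.·-closed c x∈B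
    }
    where module A = IsSubspace A
          module B = IsSubspace B

  ⊕-least : ∀ {A B S} → IsSubspace S → A ⊆′ S → B ⊆′ S → (A ⊕ B) ⊆′ S
  ⊕-least S A⊆S B⊆S x (u , w , u∈A , w∈B , x≈u+w) =
    S.respects (λ i → sym (x≈u+w i)) (S.+-closed (A⊆S u u∈A) (B⊆S w w∈B))
    where module S = IsSubspace S

  coordinate-zero-isSubspace : ∀ i → IsSubspace (λ x → x i ≡ 0f)
  coordinate-zero-isSubspace i = record
    { respects = λ x≈y xi≡0 → trans (sym (x≈y i)) xi≡0
    ; zero∈ = refl
    ; +-closed = λ xi≡0 yi≡0 → trans (cong₂ _+f_ xi≡0 yi≡0) (+-identityˡ 0f)
    ; ·-closed = λ c xi≡0 → trans (cong (c *f_) xi≡0) (zeroʳ c)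
    }

  coordinates-equal-isSubspace : ∀ i j → IsSubspace (λ x → x i ≡ x j)
  coordinates-equal-isSubspace i j = record
    { respects = λ x≈y xi≡xj → trans (sym (x≈y i)) (trans xi≡xj (x≈y j))
    ; zero∈ = refl
    ; +-closed = cong₂ _+f_
    ; ·-closed = λ c → cong (c *f_)
    }

  ⟦distFormula⟧std : ∀ {p q r v A B C} → v p ≡ A → v q ≡ B → v r ≡ C →
    ⟦ distFormula p q r ⟧std v ≡ (A ∩ (B ⊕ C)) ∩ (((A ∩ B) ⊕ (A ∩ C)) ⊥)
  ⟦distFormula⟧std refl refl refl = refl

module NonDistributivity (ℝ : CompleteOrderedField) (k : FieldChoice) (n : ℕ) where
  open Hilbert ℝ k (suc (suc n))
  open Subspaces ℝ k (suc (suc n))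
  open Sums ℝ k using (Σf-zero)
  open ScalarField ℝ using (conj-zero; one≢zero)
  open CommutativeRing (ScalarField.𝔽-commutativeRing ℝ k) using (+-identityˡ; +-identityʳ; zeroˡ; zeroʳ)

  P Q R : Subset
  P x = x 0F ≡ x 1F
  Q x = x 1F ≡ 0f
  R x = x 0F ≡ 0f

  P-isSubspace : IsSubspace P
  P-isSubspace = coordinates-equal-isSubspace 0F 1F

  Q-isSubspace : IsSubspace Q
  Q-isSubspace = coordinate-zero-isSubspace 1F

  R-isSubspace : IsSubspace R
  R-isSubspace = coordinate-zero-isSubspace 0F

  e₀ e₁ u : Vec𝔽
  e₀ 0F = 1f
  e₀ (suc _) = 0f
  e₁ 1F = 1f
  e₁ _ = 0f
  u 0F = 1f
  u 1F = 1f
  u (suc (suc _)) = 0f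

  u≈e₀+e₁ : u ≈v (e₀ +v e₁)
  u≈e₀+e₁ 0F = sym (+-identityʳ 1f)
  u≈e₀+e₁ 1F = sym (+-identityˡ 1f)
  u≈e₀+e₁ (suc (suc _)) = sym (+-identityˡ 0f)

  Z : Subset
  Z = R ∩ Q

  P∩Q⊆Z : (P ∩ Q) ⊆′ Z
  P∩Q⊆Z x (x₀≡x₁ , x₁≡0) = trans x₀≡x₁ x₁≡0 , x₁≡0

  P∩R⊆Z : (P ∩ R) ⊆′ Z
  P∩R⊆Z x (x₀≡x₁ , x₀≡0) = x₀≡0 , trans (sym x₀≡x₁) x₀≡0

  Z⊆u⊥ : Z ⊆′ λ y → ⟨ y , u ⟩ ≡ 0f
  Z⊆u⊥ y (y₀≡0 , y₁≡0) = Σf-zero {f = λ i → conj (y i) *f u i} λ where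
      0F → conj-zero-* y₀≡0
      1F → conj-zero-* y₁≡0
      (suc (suc i)) → zeroʳ (conj (y (suc (suc i))))
    where
    conj-zero-* : ∀ {a b} → a ≡ 0f → conj a *f b ≡ 0f
    conj-zero-* {b = b} a≡0 = trans (cong (λ a → conj a *f b) a≡0) (trans (cong (_*f b) (conj-zero k)) (zeroˡ b))

  u∈[P∩Q⊕P∩R]⊥ : (((P ∩ Q) ⊕ (P ∩ R)) ⊥) u
  u∈[P∩Q⊕P∩R]⊥ y y∈P∩Q⊕P∩R =
    Z⊆u⊥ y (⊕-least (∩-isSubspace R-isSubspace Q-isSubspace) P∩Q⊆Z P∩R⊆Z y y∈P∩Q⊕P∩R)

  distributivity-fails : NonZeroSubspace ((P ∩ (Q ⊕ R)) ∩ (((P ∩ Q) ⊕ (P ∩ R)) ⊥))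
  distributivity-fails =
    u , ((refl , e₀ , e₁ , refl , refl , u≈e₀+e₁) , u∈[P∩Q⊕P∩R]⊥) , λ u≈0 → one≢zero k (u≈0 0F)

  SatSTD-distFormula : ∀ {p q r} → p ≢ q → q ≢ r → p ≢ r → SatSTD (distFormula p q r)
  SatSTD-distFormula {p} {q} {r} p≢q q≢r p≢r =
    v , v-isSubspace ,
    subst NonZeroSubspace (sym (⟦distFormula⟧std {p} {q} {r} {v} vp≡P vq≡Q vr≡R)) distributivity-fails
    where
    v : ℕ → Subset
    v = const R [ q ]≔ Q [ p ]≔ P

    v-isSubspace : ∀ i → IsSubspace (v i)
    v-isSubspace =
      []≔-preserves IsSubspace p ([]≔-preserves IsSubspace q (const R-isSubspace) Q-isSubspace) P-isSubspace

    vp≡P : v p ≡ P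
    vp≡P = []≔-updates _ p P

    vq≡Q : v q ≡ Q
    vq≡Q = trans ([]≔-minimal _ P (p≢q ∘ sym)) ([]≔-updates _ q Q)

    vr≡R : v r ≡ R
    vr≡R = trans ([]≔-minimal _ P (p≢r ∘ sym)) ([]≔-minimal _ Q (q≢r ∘ sym))

mainTheorem9 : (ℝ : CompleteOrderedField) (k : FieldChoice) (d : ℕ) → 2 ≤ d →
    (p q r : ℕ) → p ≢ q → q ≢ r → p ≢ r →
    Hilbert.SatSTD ℝ k d (distFormula p q r) ×
    ¬ Hilbert.SatPBA ℝ k d (distFormula p q r)
mainTheorem9 ℝ k (suc (suc n)) (s≤s (s≤s _)) p q r p≢q q≢r p≢r =
  NonDistributivity.SatSTD-distFormula ℝ k n p≢q q≢r p≢r ,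
  ProjectorSemantics.¬SatPBA-distFormula ℝ k (suc (suc n)) p q r
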